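{- Let $G=(K\uplus S,E)$ be a connected split graph and $D_s,D_t$ two D$2$DSs of $G$ of the same size. Then $\mathrm{opt}_{\mathsf{TJ}}(G,D_s,D_t)\le M^\star_{\mathsf{TJ}}(G,D_s,D_t)+1$.
   Context: A split graph $G=(K\uplus S,E)$ has vertex set partitioned into a clique $K$ and an independent set $S$. A D$2$DS of $G$ is a set $D\subseteq V(G)$ such that every vertex is at distance at most $2$ from some vertex of $D$. A $\mathsf{TJ}$-sequence between D$2$DSs $D_s,D_t$ is a sequence $D_s=D_0,\dots,D_q=D_t$ of D$2$DSs with $D_i\setminus D_{i+1}=\{x_i\}$, $D_{i+1}\setminus D_i=\{y_i\}$ for each $i$; its length is $q$. $\mathrm{opt}_{\mathsf{TJ}}(G,D_s,D_t)$ is the minimum length of such a sequence ($\infty$ if none). $M^\star_{\mathsf{TJ}}(G,D_s,D_t)=|D_s\,\Delta\,D_t|/2$. -}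

module Defs where

open import Data.Nat using (ℕ; zero; suc; _+_; _≤_; ⌊_/2⌋)
open import Data.Fin using (Fin)
open import Data.Fin.Subset using (Subset; _∈_; _∉_; _∪_; _─_; ∣_∣)
open import Data.Product using (Σ; ∃; ∃-syntax; _×_; _,_)
open import Data.Sum using (_⊎_)
open import Data.Empty using (⊥)
open import Relation.Nullary using (¬_)
open import Relation.Binary.PropositionalEquality using (_≡_)

record Graph (n : ℕ) : Set₁ where
  field
    Adj     : Fin n → Fin n → Set
    sym     : ∀ {u v} → Adj u v → Adj v u
    irrefl  : ∀ {u} → ¬ Adj u u
open Graph public

data Walk {n : ℕ} (G : Graph n) : Fin n → Fin n → Set where
  nil  : ∀ {u} → Walk G u u
  cons : ∀ {u v w} → Adj G u v → Walk G v w → Walk G u w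

Connected : ∀ {n} → Graph n → Set
Connected G = ∀ u v → Walk G u v

-- G is a split graph with clique K and independent set S = V ∖ K.
IsSplitPartition : ∀ {n} → Graph n → Subset n → Set
IsSplitPartition G K =
  (∀ u v → u ∈ K → v ∈ K → ¬ (u ≡ v) → Adj G u v) ×
  (∀ u v → u ∉ K → v ∉ K → ¬ Adj G u v)

IsSplitGraph : ∀ {n} → Graph n → Set
IsSplitGraph {n} G = Σ (Subset n) (IsSplitPartition G)

Dist≤2 : ∀ {n} → Graph n → Fin n → Fin n → Set
Dist≤2 G u v = u ≡ v ⊎ Adj G u v ⊎ (∃[ w ] (Adj G u w × Adj G w v))

IsD2DS : ∀ {n} → Graph n → Subset n → Set
IsD2DS G D = ∀ v → ∃[ u ] (u ∈ D × Dist≤2 G u v)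

TJStep : ∀ {n} → Subset n → Subset n → Set
TJStep {n} D D' = Σ (Fin n) λ x → Σ (Fin n) λ y →
  (∀ z → (z ∈ D × z ∉ D') → z ≡ x) × (x ∈ D × x ∉ D') ×
  (∀ z → (z ∈ D' × z ∉ D) → z ≡ y) × (y ∈ D' × y ∉ D)

data TJSeq {n : ℕ} (G : Graph n) : Subset n → Subset n → ℕ → Set where
  done : ∀ {D} → IsD2DS G D → TJSeq G D D zero
  step : ∀ {D D' D'' q} → IsD2DS G D → TJStep D D' →
         TJSeq G D' D'' q → TJSeq G D D'' (suc q)

-- opt_TJ(G,Ds,Dt) ≤ m  (false when opt = ∞)
OptTJ≤ : ∀ {n} → Graph n → Subset n → Subset n → ℕ → Set
OptTJ≤ G Ds Dt m = ∃[ q ] (TJSeq G Ds Dt q × q ≤ m)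

M⋆TJ : ∀ {n} → Subset n → Subset n → ℕ
M⋆TJ Ds Dt = ⌊ ∣ (Ds ─ Dt) ∪ (Dt ─ Ds) ∣ /2⌋

-- In a connected split graph every clique vertex k is within distance 2 of every
-- vertex, so every set containing k is a D2DS.  If Ds contains k, the elements of
-- Ds ∖ Dt are exchanged one at a time for those of Dt ∖ Ds, never removing k: when
-- k ∈ Dt the exchange is made on the Ds side, and when k ∉ Dt it is made on the Dt
-- side, replacing an element of Dt ∖ Ds by k.  Every intermediate set contains k,
-- and each exchange shrinks |Ds ∖ Dt| = M* by one.  If neither set contains k, a
-- first step exchanges an element of Ds ∖ Dt for k, at the cost of one extra step.

module Submission where

open import Defs renaming (sym to Adj-sym)
open import Algebra.Properties.CommutativeSemigroup as CommSemigroupProperties using ()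
open import Data.Nat using (ℕ; zero; suc; _+_; _<_; z≤n; s≤s; ⌊_/2⌋)
open import Data.Nat.Properties
  using (+-suc; +-comm; +-cancelˡ-≡; +-commutativeSemigroup; suc-injective; 1+n≢0; n≮0;
         m≤n⇒m≤1+n; n≡⌊n+n/2⌋)
  renaming (_≟_ to _ℕ≟_)
open import Data.Fin using (Fin; zero; suc)
open import Data.Fin.Properties using (_≟_)
open import Data.Fin.Subset
  using (Subset; Side; inside; outside; ⊥; ∣_∣; _─_; _-_; _∪_; _∈_; _∉_; _⊆_; Nonempty; Empty)
open import Data.Fin.Subset.Properties
  using (_∈?_; drop-there; ∉⊥; p─⊥≡p; nonempty?; Empty-unique; ∣⊥∣≡0; ⊆-antisym;
         x∈p∧x∉q⇒x∈p─q; x∈p⇒∣p-x∣<∣p∣)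
open import Data.Bool.Properties using (¬-not)
open import Data.Vec using (Vec; []; _∷_; lookup; _[_]=_; _[_]≔_; here; there)
open import Data.Vec.Properties
  using ([]=⇒lookup; lookup⇒[]=; lookup∘update′; []≔-updates; []≔-minimal; []=-injective)
open import Data.Product using (∃; _×_; _,_; proj₁; proj₂)
open import Data.Sum using (_⊎_; inj₁; inj₂)
open import Function using (_∘_)
open import Relation.Nullary using (Dec; yes; no; contradiction)
open import Relation.Binary.PropositionalEquality
  using (_≡_; _≢_; refl; sym; trans; cong; subst; module ≡-Reasoning)

private
  variable
    n : ℕ
    p q : Subset n
    x y z : Fin n

∉⇒lookup≡outside : x ∉ p → lookup p x ≡ outside
∉⇒lookup≡outside {x = x} {p} x∉p = ¬-not (x∉p ∘ lookup⇒[]= x p)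

x∈p─q⁻ : ∀ (p q : Subset n) → x ∈ p ─ q → x ∈ p × x ∉ q
x∈p─q⁻ (_ ∷ p) (_ ∷ q) (there x∈p─q) with x∈p─q⁻ p q x∈p─q
... | x∈p , x∉q = there x∈p , x∉q ∘ drop-there
x∈p─q⁻ (inside  ∷ p) (outside ∷ q) here = here , λ ()
x∈p─q⁻ {x = zero} (outside ∷ p) (outside ∷ q) ()
x∈p─q⁻ {x = zero} (_       ∷ p) (inside  ∷ q) ()

∣p∣≢0⇒Nonempty : ∣ p ∣ ≢ 0 → Nonempty p
∣p∣≢0⇒Nonempty {n} {p} ∣p∣≢0 with nonempty? p
... | yes ne = ne
... | no ¬ne = contradiction (trans (cong ∣_∣ (Empty-unique ¬ne)) (∣⊥∣≡0 n)) ∣p∣≢0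

∣p─q∣≢0⇒∃∈p∉q : ∀ (p q : Subset n) → ∣ p ─ q ∣ ≢ 0 → ∃ λ x → x ∈ p × x ∉ q
∣p─q∣≢0⇒∃∈p∉q p q ∣p─q∣≢0 with ∣p∣≢0⇒Nonempty ∣p─q∣≢0
... | x , x∈p─q = x , x∈p─q⁻ p q x∈p─q

∣p∣≡0⇒Empty : ∣ p ∣ ≡ 0 → Empty p
∣p∣≡0⇒Empty {p = p} ∣p∣≡0 (x , x∈p) = n≮0 (subst (∣ p - x ∣ <_) ∣p∣≡0 (x∈p⇒∣p-x∣<∣p∣ x∈p))

Empty[p─q]⇒p⊆q : Empty (p ─ q) → p ⊆ q
Empty[p─q]⇒p⊆q {q = q} empty {x} x∈p with x ∈? q
... | yes x∈q = x∈q
... | no  x∉q = contradiction (x , x∈p∧x∉q⇒x∈p─q x∈p x∉q) empty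

∣p∣+∣q─p∣≡∣q∣+∣p─q∣ : ∀ (p q : Subset n) → ∣ p ∣ + ∣ q ─ p ∣ ≡ ∣ q ∣ + ∣ p ─ q ∣
∣p∣+∣q─p∣≡∣q∣+∣p─q∣ []            []            = refl
∣p∣+∣q─p∣≡∣q∣+∣p─q∣ (inside  ∷ p) (inside  ∷ q) = cong suc (∣p∣+∣q─p∣≡∣q∣+∣p─q∣ p q)
∣p∣+∣q─p∣≡∣q∣+∣p─q∣ (inside  ∷ p) (outside ∷ q) = trans (cong suc (∣p∣+∣q─p∣≡∣q∣+∣p─q∣ p q)) (sym (+-suc _ _))
∣p∣+∣q─p∣≡∣q∣+∣p─q∣ (outside ∷ p) (inside  ∷ q) = trans (+-suc _ _) (cong suc (∣p∣+∣q─p∣≡∣q∣+∣p─q∣ p q))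
∣p∣+∣q─p∣≡∣q∣+∣p─q∣ (outside ∷ p) (outside ∷ q) = ∣p∣+∣q─p∣≡∣q∣+∣p─q∣ p q

∣p─q∣≡∣q─p∣ : ∀ (p q : Subset n) → ∣ p ∣ ≡ ∣ q ∣ → ∣ p ─ q ∣ ≡ ∣ q ─ p ∣
∣p─q∣≡∣q─p∣ p q ∣p∣≡∣q∣ = sym (+-cancelˡ-≡ ∣ p ∣ _ _ (begin
  ∣ p ∣ + ∣ q ─ p ∣ ≡⟨ ∣p∣+∣q─p∣≡∣q∣+∣p─q∣ p q ⟩
  ∣ q ∣ + ∣ p ─ q ∣ ≡⟨ cong (_+ ∣ p ─ q ∣) ∣p∣≡∣q∣ ⟨
  ∣ p ∣ + ∣ p ─ q ∣ ∎))
  where open ≡-Reasoning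

∣p─q∣≡0⇒p≡q : ∀ (p q : Subset n) → ∣ p ∣ ≡ ∣ q ∣ → ∣ p ─ q ∣ ≡ 0 → p ≡ q
∣p─q∣≡0⇒p≡q p q ∣p∣≡∣q∣ ∣p─q∣≡0 = ⊆-antisym
  (Empty[p─q]⇒p⊆q (∣p∣≡0⇒Empty ∣p─q∣≡0))
  (Empty[p─q]⇒p⊆q (∣p∣≡0⇒Empty (trans (sym (∣p─q∣≡∣q─p∣ p q ∣p∣≡∣q∣)) ∣p─q∣≡0)))

∣[p─q]∪[q─p]∣ : ∀ (p q : Subset n) → ∣ (p ─ q) ∪ (q ─ p) ∣ ≡ ∣ p ─ q ∣ + ∣ q ─ p ∣
∣[p─q]∪[q─p]∣ []            []            = refl
∣[p─q]∪[q─p]∣ (inside  ∷ p) (inside  ∷ q) = ∣[p─q]∪[q─p]∣ p q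
∣[p─q]∪[q─p]∣ (inside  ∷ p) (outside ∷ q) = cong suc (∣[p─q]∪[q─p]∣ p q)
∣[p─q]∪[q─p]∣ (outside ∷ p) (inside  ∷ q) = trans (cong suc (∣[p─q]∪[q─p]∣ p q)) (sym (+-suc _ _))
∣[p─q]∪[q─p]∣ (outside ∷ p) (outside ∷ q) = ∣[p─q]∪[q─p]∣ p q

[]≔-minimal⁻ : ∀ {A : Set} {n} {xs : Vec A n} {i j : Fin n} {a b : A} →
               i ≢ j → (xs [ j ]≔ b) [ i ]= a → xs [ i ]= a
[]≔-minimal⁻ {xs = xs} {i} {j} {b = b} i≢j xs′ᵢ≡a =
  lookup⇒[]= i xs (trans (sym (lookup∘update′ i≢j xs b)) ([]=⇒lookup xs′ᵢ≡a))

∉-[]≔outside : y ∉ p → y ∉ p [ x ]≔ outside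
∉-[]≔outside {y = y} {p} {x} y∉p y∈p′ with y ≟ x
... | yes refl = contradiction ([]=-injective y∈p′ ([]≔-updates p y)) λ ()
... | no  y≢x  = y∉p ([]≔-minimal⁻ y≢x y∈p′)

∣_─_∣ᵇ : Side → Side → ℕ
∣ inside  ─ outside ∣ᵇ = 1
∣ _       ─ _       ∣ᵇ = 0

∣∷─∷∣ : ∀ a b (p q : Subset n) → ∣ (a ∷ p) ─ (b ∷ q) ∣ ≡ ∣ a ─ b ∣ᵇ + ∣ p ─ q ∣
∣∷─∷∣ inside  inside  p q = refl
∣∷─∷∣ inside  outside p q = refl
∣∷─∷∣ outside inside  p q = refl
∣∷─∷∣ outside outside p q = refl

∣[]≔─∣ : ∀ (p q : Subset n) x a →
         ∣ a ─ lookup q x ∣ᵇ + ∣ p ─ q ∣ ≡ ∣ lookup p x ─ lookup q x ∣ᵇ + ∣ (p [ x ]≔ a) ─ q ∣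
∣[]≔─∣ (s ∷ p) (t ∷ q) zero a
  rewrite ∣∷─∷∣ s t p q | ∣∷─∷∣ a t p q = x∙yz≈y∙xz ∣ a ─ t ∣ᵇ ∣ s ─ t ∣ᵇ ∣ p ─ q ∣
  where open CommSemigroupProperties +-commutativeSemigroup
∣[]≔─∣ (s ∷ p) (t ∷ q) (suc x) a
  rewrite ∣∷─∷∣ s t p q | ∣∷─∷∣ s t (p [ x ]≔ a) q = begin
    new + (head + rest)  ≡⟨ x∙yz≈y∙xz new head rest ⟩
    head + (new + rest)  ≡⟨ cong (head +_) (∣[]≔─∣ p q x a) ⟩
    head + (old + rest′) ≡⟨ x∙yz≈y∙xz head old rest′ ⟩
    old + (head + rest′) ∎
  where
  open ≡-Reasoning
  open CommSemigroupProperties +-commutativeSemigroup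
  head new old rest rest′ : ℕ
  head  = ∣ s ─ t ∣ᵇ
  new   = ∣ a ─ lookup q x ∣ᵇ
  old   = ∣ lookup p x ─ lookup q x ∣ᵇ
  rest  = ∣ p ─ q ∣
  rest′ = ∣ (p [ x ]≔ a) ─ q ∣

∣─∣-remove : x ∈ p → x ∉ q → ∣ p ─ q ∣ ≡ suc ∣ (p [ x ]≔ outside) ─ q ∣
∣─∣-remove {x = x} {p} {q} x∈p x∉q
  with ∣[]≔─∣ p q x outside
... | eq rewrite []=⇒lookup x∈p | ∉⇒lookup≡outside x∉q = eq

∣─∣-add-∈ : y ∉ p → y ∈ q → ∣ (p [ y ]≔ inside) ─ q ∣ ≡ ∣ p ─ q ∣
∣─∣-add-∈ {y = y} {p} {q} y∉p y∈q
  with ∣[]≔─∣ p q y inside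
... | eq rewrite ∉⇒lookup≡outside y∉p | []=⇒lookup y∈q = sym eq

∣─∣-add-∉ : y ∉ p → y ∉ q → ∣ (p [ y ]≔ inside) ─ q ∣ ≡ suc ∣ p ─ q ∣
∣─∣-add-∉ {y = y} {p} {q} y∉p y∉q
  with ∣[]≔─∣ p q y inside
... | eq rewrite ∉⇒lookup≡outside y∉p | ∉⇒lookup≡outside y∉q = sym eq

swap : Subset n → Fin n → Fin n → Subset n
swap p x y = (p [ x ]≔ outside) [ y ]≔ inside

y∈swap : ∀ (p : Subset n) x y → y ∈ swap p x y
y∈swap p x y = []≔-updates (p [ x ]≔ outside) y

x∉swap : x ≢ y → x ∉ swap p x y
x∉swap {x = x} {y} {p} x≢y x∈swap =
  contradiction ([]=-injective x∈swap ([]≔-minimal _ x y x≢y ([]≔-updates p x))) λ ()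

∈-swap⁺ : z ≢ x → z ≢ y → z ∈ p → z ∈ swap p x y
∈-swap⁺ {z = z} {x} {y} {p} z≢x z≢y z∈p = []≔-minimal _ z y z≢y ([]≔-minimal p z x z≢x z∈p)

∈-swap⁻ : z ≢ x → z ≢ y → z ∈ swap p x y → z ∈ p
∈-swap⁻ z≢x z≢y = []≔-minimal⁻ z≢x ∘ []≔-minimal⁻ z≢y

∣swap∣ : x ∈ p → y ∉ p → ∣ swap p x y ∣ ≡ ∣ p ∣
∣swap∣ {x = x} {p} {y} x∈p y∉p = begin
  ∣ swap p x y ∣                 ≡⟨ cong ∣_∣ (p─⊥≡p (swap p x y)) ⟨
  ∣ swap p x y ─ ⊥ ∣             ≡⟨ ∣─∣-add-∉ (∉-[]≔outside y∉p) ∉⊥ ⟩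
  suc ∣ (p [ x ]≔ outside) ─ ⊥ ∣ ≡⟨ ∣─∣-remove x∈p ∉⊥ ⟨
  ∣ p ─ ⊥ ∣                      ≡⟨ cong ∣_∣ (p─⊥≡p p) ⟩
  ∣ p ∣                          ∎
  where open ≡-Reasoning

∣─∣-swap-∈ : x ∈ p → x ∉ q → y ∉ p → y ∈ q → ∣ p ─ q ∣ ≡ suc ∣ swap p x y ─ q ∣
∣─∣-swap-∈ x∈p x∉q y∉p y∈q =
  trans (∣─∣-remove x∈p x∉q) (cong suc (sym (∣─∣-add-∈ (∉-[]≔outside y∉p) y∈q)))

∣─∣-swap-∉ : x ∈ p → x ∉ q → y ∉ p → y ∉ q → ∣ swap p x y ─ q ∣ ≡ ∣ p ─ q ∣
∣─∣-swap-∉ x∈p x∉q y∉p y∉q =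
  trans (∣─∣-add-∉ (∉-[]≔outside y∉p) y∉q) (sym (∣─∣-remove x∈p x∉q))

swap-TJStep : x ∈ p → y ∉ p → TJStep p (swap p x y)
swap-TJStep {x = x} {p} {y} x∈p y∉p =
  x , y , removed-only-x , (x∈p , x∉swap x≢y) , added-only-y , (y∈swap p x y , y∉p)
  where
  x≢y : x ≢ y
  x≢y refl = y∉p x∈p
  removed-only-x : ∀ z → z ∈ p × z ∉ swap p x y → z ≡ x
  removed-only-x z (z∈p , z∉swap) with z ≟ x | z ≟ y
  ... | yes z≡x | _        = z≡x
  ... | no  _   | yes refl = contradiction z∈p y∉p
  ... | no  z≢x | no  z≢y  = contradiction (∈-swap⁺ z≢x z≢y z∈p) z∉swap
  added-only-y : ∀ z → z ∈ swap p x y × z ∉ p → z ≡ y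
  added-only-y z (z∈swap , z∉p) with z ≟ y | z ≟ x
  ... | yes z≡y | _        = z≡y
  ... | no  _   | yes refl = contradiction x∈p z∉p
  ... | no  z≢y | no  z≢x  = contradiction (∈-swap⁻ z≢x z≢y z∈swap) z∉p

TJStep-sym : {D D′ : Subset n} → TJStep D D′ → TJStep D′ D
TJStep-sym (x , y , only-x , x-out , only-y , y-in) = y , x , only-y , y-in , only-x , x-out

module _ {n} {G : Graph n} where

  TJSeq-snoc : ∀ {A B C q} → TJSeq G A B q → TJStep B C → IsD2DS G C → TJSeq G A C (suc q)
  TJSeq-snoc (done hA)        B→C hC = step hA B→C (done hC)
  TJSeq-snoc (step hA A→A′ s) B→C hC = step hA A→A′ (TJSeq-snoc s B→C hC)

  TJSeq-reverse : ∀ {A B q} → TJSeq G A B q → TJSeq G B A q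
  TJSeq-reverse (done hA)        = done hA
  TJSeq-reverse (step hA A→A′ s) = TJSeq-snoc (TJSeq-reverse s) (TJStep-sym A→A′) hA

  OptTJ≤-refl : ∀ {D m} → IsD2DS G D → OptTJ≤ G D D m
  OptTJ≤-refl hD = 0 , done hD , z≤n

  OptTJ≤-sym : ∀ {A B m} → OptTJ≤ G A B m → OptTJ≤ G B A m
  OptTJ≤-sym (q , s , q≤m) = q , TJSeq-reverse s , q≤m

  OptTJ≤-stepˡ : ∀ {A A′ B m} → IsD2DS G A → TJStep A A′ → OptTJ≤ G A′ B m → OptTJ≤ G A B (suc m)
  OptTJ≤-stepˡ hA A→A′ (q , s , q≤m) = suc q , step hA A→A′ s , s≤s q≤m

  OptTJ≤-stepʳ : ∀ {A B′ B m} → OptTJ≤ G A B′ m → TJStep B′ B → IsD2DS G B → OptTJ≤ G A B (suc m)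
  OptTJ≤-stepʳ (q , s , q≤m) B′→B hB = suc q , TJSeq-snoc s B′→B hB , s≤s q≤m

  OptTJ≤-weaken : ∀ {A B m} → OptTJ≤ G A B m → OptTJ≤ G A B (suc m)
  OptTJ≤-weaken (q , s , q≤m) = q , s , m≤n⇒m≤1+n q≤m

module _ {n} {G : Graph n} {K : Subset n} (split : IsSplitPartition G K) where

  edge-meets-clique : ∀ {u v} → Adj G u v → u ∈ K ⊎ v ∈ K
  edge-meets-clique {u} {v} uv with u ∈? K | v ∈? K
  ... | yes u∈K | _       = inj₁ u∈K
  ... | no  _   | yes v∈K = inj₂ v∈K
  ... | no  u∉K | no  v∉K = contradiction uv (proj₂ split u v u∉K v∉K)

  clique-nonempty : ∀ {x y} → Connected G → x ≢ y → Nonempty K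
  clique-nonempty {x} {y} conn x≢y with conn x y
  ... | nil = contradiction refl x≢y
  ... | cons {v = w} xw _ with edge-meets-clique xw
  ... | inj₁ x∈K = x , x∈K
  ... | inj₂ w∈K = w , w∈K

  module _ (conn : Connected G) {k} (k∈K : k ∈ K) where

    clique-vertex-dominates : ∀ v → Dist≤2 G k v
    clique-vertex-dominates v with v ≟ k
    ... | yes refl = inj₁ refl
    ... | no v≢k with v ∈? K | conn v k
    ... | yes v∈K | _   = inj₂ (inj₁ (proj₁ split k v k∈K v∈K (v≢k ∘ sym)))
    ... | no  _   | nil = contradiction refl v≢k
    ... | no  v∉K | cons {v = u} vu _ with u ≟ k | edge-meets-clique vu
    ... | yes refl | _        = inj₂ (inj₁ (Adj-sym G vu))
    ... | no  _    | inj₁ v∈K = contradiction v∈K v∉K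
    ... | no  u≢k  | inj₂ u∈K = inj₂ (inj₂ (u , proj₁ split k u k∈K u∈K (u≢k ∘ sym) , Adj-sym G vu))

    ∈⇒IsD2DS : ∀ {D} → k ∈ D → IsD2DS G D
    ∈⇒IsD2DS k∈D v = k , k∈D , clique-vertex-dominates v

    reconfigure-from : ∀ j {A B} → k ∈ A → IsD2DS G B → ∣ A ∣ ≡ ∣ B ∣ → ∣ A ─ B ∣ ≡ j →
                       OptTJ≤ G A B j
    reconfigure-from zero {A} {B} k∈A hB ∣A∣≡∣B∣ ∣A─B∣≡0
      with refl ← ∣p─q∣≡0⇒p≡q A B ∣A∣≡∣B∣ ∣A─B∣≡0 = OptTJ≤-refl hB
    reconfigure-from (suc j) {A} {B} k∈A hB ∣A∣≡∣B∣ ∣A─B∣≡1+j =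
      swap-towards (∣p─q∣≢0⇒∃∈p∉q A B (1+n≢0 ∘ trans (sym ∣A─B∣≡1+j)))
                   (∣p─q∣≢0⇒∃∈p∉q B A (1+n≢0 ∘ trans (sym ∣B─A∣≡1+j)))
                   (k ∈? B)
      where
      ∣B─A∣≡1+j : ∣ B ─ A ∣ ≡ suc j
      ∣B─A∣≡1+j = trans (∣p─q∣≡∣q─p∣ B A (sym ∣A∣≡∣B∣)) ∣A─B∣≡1+j

      swap-towards : (∃ λ x → x ∈ A × x ∉ B) → (∃ λ y → y ∈ B × y ∉ A) → Dec (k ∈ B) →
                     OptTJ≤ G A B (suc j)
      swap-towards (x , x∈A , x∉B) (y , y∈B , y∉A) (yes k∈B) =
        OptTJ≤-stepˡ (∈⇒IsD2DS k∈A) (swap-TJStep x∈A y∉A)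
          (reconfigure-from j (∈-swap⁺ k≢x k≢y k∈A) hB (trans (∣swap∣ x∈A y∉A) ∣A∣≡∣B∣)
            (suc-injective (trans (sym (∣─∣-swap-∈ x∈A x∉B y∉A y∈B)) ∣A─B∣≡1+j)))
        where
        k≢x : k ≢ x
        k≢x refl = x∉B k∈B
        k≢y : k ≢ y
        k≢y refl = y∉A k∈A
      swap-towards _ (y , y∈B , y∉A) (no k∉B) =
        OptTJ≤-stepʳ (reconfigure-from j k∈A (∈⇒IsD2DS (y∈swap B y k)) ∣A∣≡∣B′∣ ∣A─B′∣≡j)
          (TJStep-sym (swap-TJStep y∈B k∉B)) hB
        where
        B′ : Subset n
        B′ = swap B y k
        ∣A∣≡∣B′∣ : ∣ A ∣ ≡ ∣ B′ ∣
        ∣A∣≡∣B′∣ = trans ∣A∣≡∣B∣ (sym (∣swap∣ y∈B k∉B))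
        ∣A─B′∣≡j : ∣ A ─ B′ ∣ ≡ j
        ∣A─B′∣≡j = suc-injective (begin
          suc ∣ A ─ B′ ∣ ≡⟨ cong suc (∣p─q∣≡∣q─p∣ A B′ ∣A∣≡∣B′∣) ⟩
          suc ∣ B′ ─ A ∣ ≡⟨ ∣─∣-swap-∈ y∈B y∉A k∉B k∈A ⟨
          ∣ B ─ A ∣      ≡⟨ ∣B─A∣≡1+j ⟩
          suc j          ∎)
          where open ≡-Reasoning

    reconfigure : ∀ {A B x} → IsD2DS G A → IsD2DS G B → ∣ A ∣ ≡ ∣ B ∣ → x ∈ A → x ∉ B →
                  OptTJ≤ G A B (suc ∣ A ─ B ∣)
    reconfigure {A} {B} {x} hA hB ∣A∣≡∣B∣ x∈A x∉B with k ∈? A | k ∈? B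
    ... | yes k∈A | _ = OptTJ≤-weaken (reconfigure-from _ k∈A hB ∣A∣≡∣B∣ refl)
    ... | no  _   | yes k∈B = OptTJ≤-weaken (OptTJ≤-sym
      (reconfigure-from _ k∈B hA (sym ∣A∣≡∣B∣) (∣p─q∣≡∣q─p∣ B A (sym ∣A∣≡∣B∣))))
    ... | no  k∉A | no  k∉B = OptTJ≤-stepˡ hA (swap-TJStep x∈A k∉A)
      (reconfigure-from _ (y∈swap A x k) hB (trans (∣swap∣ x∈A k∉A) ∣A∣≡∣B∣) (∣─∣-swap-∉ x∈A x∉B k∉A k∉B))

reconfigure-split : ∀ {n} {G : Graph n} {A B} → IsSplitGraph G → Connected G →
                    IsD2DS G A → IsD2DS G B → ∣ A ∣ ≡ ∣ B ∣ → OptTJ≤ G A B (suc ∣ A ─ B ∣)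
reconfigure-split {A = A} {B} (K , split) conn hA hB ∣A∣≡∣B∣ with ∣ A ─ B ∣ ℕ≟ 0
... | yes ∣A─B∣≡0 with refl ← ∣p─q∣≡0⇒p≡q A B ∣A∣≡∣B∣ ∣A─B∣≡0 = OptTJ≤-refl hA
... | no  ∣A─B∣≢0 with ∣p─q∣≢0⇒∃∈p∉q A B ∣A─B∣≢0
... | x , x∈A , x∉B with hB x
... | u , u∈B , _ with clique-nonempty split {x} {u} conn (λ { refl → x∉B u∈B })
... | k , k∈K = reconfigure split conn k∈K hA hB ∣A∣≡∣B∣ x∈A x∉B

M⋆TJ≡∣─∣ : ∀ (p q : Subset n) → ∣ p ∣ ≡ ∣ q ∣ → M⋆TJ p q ≡ ∣ p ─ q ∣
M⋆TJ≡∣─∣ p q ∣p∣≡∣q∣ = begin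
  ⌊ ∣ (p ─ q) ∪ (q ─ p) ∣ /2⌋      ≡⟨ cong ⌊_/2⌋ (∣[p─q]∪[q─p]∣ p q) ⟩
  ⌊ ∣ p ─ q ∣ + ∣ q ─ p ∣ /2⌋      ≡⟨ cong (λ d → ⌊ ∣ p ─ q ∣ + d /2⌋) (∣p─q∣≡∣q─p∣ p q ∣p∣≡∣q∣) ⟨
  ⌊ ∣ p ─ q ∣ + ∣ p ─ q ∣ /2⌋      ≡⟨ n≡⌊n+n/2⌋ ∣ p ─ q ∣ ⟨
  ∣ p ─ q ∣                        ∎
  where open ≡-Reasoning

lemma16 : ∀ {n} (G : Graph n) → IsSplitGraph G → Connected G →
          (Ds Dt : Subset n) → IsD2DS G Ds → IsD2DS G Dt → ∣ Ds ∣ ≡ ∣ Dt ∣ →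
          OptTJ≤ G Ds Dt (M⋆TJ Ds Dt + 1)
lemma16 G split conn Ds Dt hs ht ∣Ds∣≡∣Dt∣ =
  subst (OptTJ≤ G Ds Dt) bound (reconfigure-split split conn hs ht ∣Ds∣≡∣Dt∣)
  where
  bound : suc ∣ Ds ─ Dt ∣ ≡ M⋆TJ Ds Dt + 1
  bound = trans (+-comm 1 _) (cong (_+ 1) (sym (M⋆TJ≡∣─∣ Ds Dt ∣Ds∣≡∣Dt∣)))
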